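{- Let $d$ and $t$ be positive integers. Suppose $G$ is a graph with average degree at least $2^{d+2}(2^{d+1}t)^{2^{d-1}}$ and separation dimension at most $d$. Then there is a bipartite subgraph $G'$ of $G$ with bipartition $(A',B')$ and minimum degree at least $t$, such that $G'$ has a separating representation consisting of $d$ linear orderings which is consistent and is $A'$-homogeneous or $B'$-homogeneous.
   Context: A representation of a graph $G$ is a non-empty set of linear orderings of $V(G)$; it is separating if for every pair of disjoint edges $e,f$ some ordering puts both endpoints of $e$ before both endpoints of $f$ or vice versa. The separation dimension of $G$ is the minimum size of a separating representation. Let $G$ be bipartite with bipartition $(A,B)$. A representation $\{<_1,\dots,<_d\}$ is consistent if for every edge $vw$ with $v\in A$, $w\in B$, we have $v<_i w$ for all $i\in\{1,\dots,d\}$. It is $A$-homogeneous if there are $a_1,\dots,a_d\in\{ -1,+1\}$ such that for every $v\in A$ there is a linear ordering $<_v$ of the neighbourhood $N_G(v)$ with: for each $i$, if $a_i=1$ then $N_G(v)$ is ordered in $<_i$ according to $<_v$, and if $a_i=-1$ then $N_G(v)$ is ordered in $<_i$ according to the reverse of $<_v$. $B$-homogeneous is defined analogously with the roles of $A$ and $B$ exchanged. -}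

module Defs where

open import Level using (0ℓ)
open import Data.Nat using (ℕ; zero; suc; _+_; _*_; _∸_; _^_; _≤_)
open import Data.Bool using (Bool; true; false; if_then_else_)
open import Data.Fin using (Fin)
open import Data.List using (List; map; allFin; filter; length)
open import Data.Nat.ListAction using (sum)
open import Data.Product using (Σ; _×_; _,_; proj₁; ∃-syntax)
open import Data.Sum using (_⊎_)
open import Data.Sign using (Sign)
open import Function using (_∘_)
open import Function.Definitions using (Injective)
open import Relation.Binary using (Rel; IsStrictTotalOrder)
open import Relation.Binary.PropositionalEquality using (_≡_; _≢_)
open import Relation.Nullary using (¬_)

record Graph : Set where
  field
    n      : ℕ
    adj    : Fin n → Fin n → Bool
    symm   : ∀ u v → adj u v ≡ adj v u
    irrefl : ∀ v → adj v v ≡ false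
open Graph public

Edge : (G : Graph) → Fin (n G) → Fin (n G) → Set
Edge G u v = adj G u v ≡ true

degree : (G : Graph) → Fin (n G) → ℕ
degree G v = length (filter (λ w → Data.Bool._≟_ (adj G v w) true) (allFin (n G)))
  where import Data.Bool

degreeSum : Graph → ℕ
degreeSum G = sum (map (degree G) (allFin (n G)))

-- average degree at least K :  (Σ_v deg v) / |V| ≥ K, i.e. Σ_v deg v ≥ K·|V|
AvgDegreeAtLeast : Graph → ℕ → Set
AvgDegreeAtLeast G K = K * n G ≤ degreeSum G

MinDegreeAtLeast : Graph → ℕ → Set
MinDegreeAtLeast G t = ∀ v → t ≤ degree G v

record LinearOrder (A : Set) : Set₁ where
  field
    _<_     : Rel A 0ℓ
    isSTO   : IsStrictTotalOrder _≡_ _<_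
open LinearOrder public

Before : ∀ {A} → LinearOrder A → A → A → A → A → Set
Before L u v x y = (_<_ L u x × _<_ L u y) × (_<_ L v x × _<_ L v y)

Representation : Graph → ℕ → Set₁
Representation G k = Fin k → LinearOrder (Fin (n G))

Separating : (G : Graph) {k : ℕ} → Representation G k → Set
Separating G {k} R =
  ∀ u v x y → Edge G u v → Edge G x y →
  u ≢ x → u ≢ y → v ≢ x → v ≢ y →
  ∃[ i ] (Before (R i) u v x y ⊎ Before (R i) x y u v)

-- separation dimension at most d: a separating representation
-- (non-empty set of orderings) of size at most d exists
SepDimAtMost : Graph → ℕ → Set₁
SepDimAtMost G d =
  Σ ℕ λ k → (1 ≤ k) × (k ≤ d) × Σ (Representation G k) λ R → Separating G R

-- H is (isomorphic to) a subgraph of G via the injective vertex map f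
SubgraphVia : (H G : Graph) → (Fin (n H) → Fin (n G)) → Set
SubgraphVia H G f = Injective _≡_ _≡_ f × (∀ u v → Edge H u v → Edge G (f u) (f v))

-- side : V → Bool encodes a bipartition (A,B) with A = side⁻¹(false),
-- B = side⁻¹(true); every edge joins A and B
IsBipartition : (G : Graph) → (Fin (n G) → Bool) → Set
IsBipartition G side = ∀ u v → Edge G u v → side u ≢ side v

Consistent : (G : Graph) (side : Fin (n G) → Bool) {k : ℕ} → Representation G k → Set
Consistent G side {k} R =
  ∀ v w → Edge G v w → side v ≡ false → side w ≡ true → ∀ i → _<_ (R i) v w

Nbhd : (G : Graph) → Fin (n G) → Set
Nbhd G v = Σ (Fin (n G)) λ w → Edge G v w

OrderedAs : (G : Graph) (v : Fin (n G)) → LinearOrder (Fin (n G)) →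
            Sign → LinearOrder (Nbhd G v) → Set
OrderedAs G v L Sign.+ Lv = ∀ w w' → _<_ Lv w w' → _<_ L (proj₁ w) (proj₁ w')
OrderedAs G v L Sign.- Lv = ∀ w w' → _<_ Lv w w' → _<_ L (proj₁ w') (proj₁ w)

-- homogeneous w.r.t. the side s of the bipartition
-- (s = false : A-homogeneous, s = true : B-homogeneous)
Homogeneous : (G : Graph) (side : Fin (n G) → Bool) (s : Bool) {k : ℕ} →
              Representation G k → Set₁
Homogeneous G side s {k} R =
  Σ (Fin k → Sign) λ a →
    ∀ v → side v ≡ s →
      Σ (LinearOrder (Nbhd G v)) λ Lv → ∀ i → OrderedAs G v (R i) (a i) Lv

bound : ℕ → ℕ → ℕ
bound d t = 2 ^ (d + 2) * (2 ^ (d + 1) * t) ^ (2 ^ (d ∸ 1))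

module Submission where

-- The subgraph is then extracted in four stages:
--  1. a large cut, pruned order by order so that all its edges go up in every
--     order after reversing some of them, losing 2^(d+1) (consistent-part);
--  2. a first core, of minimum degree K = x^(2^(d-1)) with x = 2^(d+1) t
--     (first-core);
--  3. on the larger side of that core, neighbourhoods shrunk from K to x
--     vertices on which all orders agree up to a common sign pattern, by
--     Erdős–Szekeres for one order after another (star-system);
--  4. the resulting stars still have average degree 2t, so they contain a
--     core of minimum degree t (star-skeleton), which is cut out as the
--     required subgraph (skeleton-subgraph).

open import Defs
open import Data.Nat using (ℕ; zero; suc; pred; _+_; _*_; _^_; _≤_; _≤?_; z≤n; s≤s; NonZero; >-nonZero)
  renaming (_<_ to _<ℕ_)
open import Data.Nat.Properties
open import Data.Bool using (Bool; true; false; _∧_; _∨_; not; if_then_else_)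
open import Data.Fin using (Fin; zero; suc; splitAt; _↑ˡ_)
import Data.Fin as Fin
open import Data.Fin.Properties using (any?; splitAt-↑ˡ) renaming (suc-injective to fsuc-injective)
open import Data.Product using (Σ; _×_; _,_; proj₁; proj₂; ∃-syntax)
open import Data.Sum using (_⊎_; inj₁; inj₂; [_,_]′; map₂)
open import Function using (_∘_)
open import Relation.Binary.PropositionalEquality
open import Relation.Nullary using (yes; no; does; contradiction)
open import Relation.Nullary.Decidable using (_×-dec_)
open import Relation.Binary using (IsStrictTotalOrder; Tri; tri<; tri≈; tri>)
import Relation.Binary.Construct.Flip.EqAndOrd as Flip
open import Function.Definitions using (Injective)
open import Data.Sign using (Sign)
open import Axiom.UniquenessOfIdentityProofs using (module Decidable⇒UIP)
open import Data.List using (map; filter; length; tabulate)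
import Data.Nat.ListAction as ListSum
open import Data.Nat.Tactic.RingSolver using (solve-∀)
import Data.Bool.Properties as Bool
open import Algebra.Properties.Semiring.Sum +-*-semiring
  using (sum; sum-cong-≗; sum-replicate-zero; ∑-distrib-+; *-distribˡ-sum)

private variable N : ℕ

𝟙 : Bool → ℕ
𝟙 true  = 1
𝟙 false = 0

∧-true : {a b : Bool} → a ∧ b ≡ true → a ≡ true × b ≡ true
∧-true {true} {true} _ = refl , refl

∨-true : {a b : Bool} → a ∨ b ≡ true → a ≡ true ⊎ b ≡ true
∨-true {true}  _ = inj₁ refl
∨-true {false} b = inj₂ b

≟-sound : {x y : Fin N} → does (x Fin.≟ y) ≡ true → x ≡ y
≟-sound {x = x} {y} eq with x Fin.≟ y
... | yes x≡y = x≡y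

≟-refl : (x : Fin N) → does (x Fin.≟ x) ≡ true
≟-refl x with x Fin.≟ x
... | yes _  = refl
... | no x≢x = contradiction refl x≢x

Subset : ℕ → Set
Subset N = Fin N → Bool

∣_∣ : Subset N → ℕ
∣ S ∣ = sum (λ v → 𝟙 (S v))

_⊆_ : Subset N → Subset N → Set
S ⊆ T = ∀ v → S v ≡ true → T v ≡ true

indicator-positive : {b : Bool} → 0 <ℕ 𝟙 b → b ≡ true
indicator-positive {true} _ = refl

indicator-mono : {a b : Bool} → (a ≡ true → b ≡ true) → 𝟙 a ≤ 𝟙 b
indicator-mono {false} _   = z≤n
indicator-mono {true}  a⇒b rewrite a⇒b refl = ≤-refl

sum-zero : sum {N} (λ _ → 0) ≡ 0
sum-zero {N} = sum-replicate-zero N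

sum-mono : {f g : Fin N → ℕ} → (∀ i → f i ≤ g i) → sum f ≤ sum g
sum-mono {zero}  f≤g = z≤n
sum-mono {suc N} f≤g = +-mono-≤ (f≤g zero) (sum-mono (f≤g ∘ suc))

sum-positive : (f : Fin N → ℕ) → 0 <ℕ sum f → ∃[ i ] 0 <ℕ f i
sum-positive {suc N} f pos with f zero in eq
... | suc _ = zero , subst (0 <ℕ_) (sym eq) (s≤s z≤n)
... | zero  = let i , p = sum-positive (f ∘ suc) pos in suc i , p

at : Fin N → Fin N → ℕ → ℕ
at v u x = if does (u Fin.≟ v) then x else 0

sum-at : (v : Fin N) (f : Fin N → ℕ) → sum (λ u → at v u (f u)) ≡ f v
sum-at {suc N} zero    f = trans (cong (f zero +_) (sum-zero {N})) (+-identityʳ (f zero))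
sum-at {suc N} (suc v) f = sum-at v (f ∘ suc)

sum-at-inner : (v u : Fin N) (f : Fin N → ℕ) → sum (λ w → at v u (f w)) ≡ at v u (sum f)
sum-at-inner {N} v u f with does (u Fin.≟ v)
... | true  = refl
... | false = sum-zero {N}

Σ² : (Fin N → Fin N → ℕ) → ℕ
Σ² f = sum (λ u → sum (f u))

row col : (Fin N → Fin N → ℕ) → Fin N → ℕ
row f v = sum (f v)
col f v = sum (λ u → f u v)

∑²-distrib-+ : (f g : Fin N → Fin N → ℕ) → Σ² (λ u w → f u w + g u w) ≡ Σ² f + Σ² g
∑²-distrib-+ f g = begin
  sum (λ u → sum (λ w → f u w + g u w)) ≡⟨ sum-cong-≗ (λ u → ∑-distrib-+ (f u) (g u)) ⟩
  sum (λ u → sum (f u) + sum (g u))     ≡⟨ ∑-distrib-+ (λ u → sum (f u)) (λ u → sum (g u)) ⟩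
  Σ² f + Σ² g                           ∎
  where open ≡-Reasoning

module _ (v : Fin N) where

  private
    spread : (f g : Fin N → Fin N → ℕ) → Fin N → Fin N → ℕ
    spread f g u w = f u w + at v u (g u w) + at v w (g u w)

    sum-spread : ∀ f g → Σ² (spread f g) ≡ Σ² f + row g v + col g v
    sum-spread f g = begin
      Σ² (spread f g)
        ≡⟨ ∑²-distrib-+ (λ u w → f u w + at v u (g u w)) (λ u w → at v w (g u w)) ⟩
      Σ² (λ u w → f u w + at v u (g u w)) + Σ² (λ u w → at v w (g u w))
        ≡⟨ cong₂ _+_ (∑²-distrib-+ f (λ u w → at v u (g u w)))
                     (sum-cong-≗ (λ u → sum-at v (g u))) ⟩
      Σ² f + sum (λ u → sum (λ w → at v u (g u w))) + col g v
        ≡⟨ cong (λ x → Σ² f + x + col g v)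
                (trans (sum-cong-≗ (λ u → sum-at-inner v u (g u))) (sum-at v (row g))) ⟩
      Σ² f + row g v + col g v ∎
      where open ≡-Reasoning

    spread-swap : ∀ f g → (∀ u w → u ≢ v → w ≢ v → f u w ≡ g u w) → f v v ≡ g v v →
                  ∀ u w → spread f g u w ≡ spread g f u w
    spread-swap f g off diag u w with u Fin.≟ v | w Fin.≟ v
    ... | yes refl | yes refl rewrite diag = refl
    ... | yes refl | no  _    = cong (_+ 0) (+-comm (f v w) (g v w))
    ... | no  _    | yes refl = swap-ends (f u w) (g u w)
      where swap-ends : ∀ a b → a + 0 + b ≡ b + 0 + a
            swap-ends a b rewrite +-identityʳ a | +-identityʳ b = +-comm a b
    ... | no u≢v   | no w≢v   = cong (λ x → x + 0 + 0) (off u w u≢v w≢v)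

  -- If f and g agree off the cross through (v , v), exchanging them moves
  -- exactly the mass of that cross.
  cross-exchange : (f g : Fin N → Fin N → ℕ) →
    (∀ u w → u ≢ v → w ≢ v → f u w ≡ g u w) → f v v ≡ g v v →
    Σ² f + row g v + col g v ≡ Σ² g + row f v + col f v
  cross-exchange f g off diag = begin
    Σ² f + row g v + col g v ≡⟨ sum-spread f g ⟨
    Σ² (spread f g)          ≡⟨ sum-cong-≗ (λ u → sum-cong-≗ (spread-swap f g off diag u)) ⟩
    Σ² (spread g f)          ≡⟨ sum-spread g f ⟩
    Σ² g + row f v + col f v ∎
    where open ≡-Reasoning

_∖_ : Subset N → Fin N → Subset N
(S ∖ v) u = S u ∧ not (does (u Fin.≟ v))

insert : Fin N → Subset N → Subset N
insert x S u = S u ∨ does (u Fin.≟ x)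

insert-here : (x : Fin N) (S : Subset N) → insert x S x ≡ true
insert-here x S = trans (cong (S x ∨_) (≟-refl x)) (Bool.∨-zeroʳ (S x))

∖-self : (S : Subset N) (v : Fin N) → (S ∖ v) v ≡ false
∖-self S v with v Fin.≟ v
... | yes _  = Bool.∧-zeroʳ (S v)
... | no v≢v = contradiction refl v≢v

∖-other : (S : Subset N) {u v : Fin N} → u ≢ v → (S ∖ v) u ≡ S u
∖-other S {u} {v} u≢v with u Fin.≟ v
... | yes u≡v = contradiction u≡v u≢v
... | no  _   = Bool.∧-identityʳ (S u)

count-point : (S : Subset N) (v : Fin N) → ∣ S ∣ ≡ ∣ S ∖ v ∣ + 𝟙 (S v)
count-point S v = begin
  ∣ S ∣                                            ≡⟨ sum-cong-≗ split ⟩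
  sum (λ u → 𝟙 ((S ∖ v) u) + at v u (𝟙 (S u)))   ≡⟨ ∑-distrib-+ (λ u → 𝟙 ((S ∖ v) u)) _ ⟩
  ∣ S ∖ v ∣ + sum (λ u → at v u (𝟙 (S u)))        ≡⟨ cong (∣ S ∖ v ∣ +_) (sum-at v (𝟙 ∘ S)) ⟩
  ∣ S ∖ v ∣ + 𝟙 (S v)                              ∎
  where
  open ≡-Reasoning
  split : ∀ u → 𝟙 (S u) ≡ 𝟙 ((S ∖ v) u) + at v u (𝟙 (S u))
  split u with does (u Fin.≟ v) | S u
  ... | true  | true  = refl
  ... | true  | false = refl
  ... | false | true  = refl
  ... | false | false = refl

count-remove : (S : Subset N) (v : Fin N) → S v ≡ true → ∣ S ∣ ≡ suc ∣ S ∖ v ∣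
count-remove S v v∈S = begin
  ∣ S ∣               ≡⟨ count-point S v ⟩
  ∣ S ∖ v ∣ + 𝟙 (S v) ≡⟨ cong (λ b → ∣ S ∖ v ∣ + 𝟙 b) v∈S ⟩
  ∣ S ∖ v ∣ + 1       ≡⟨ +-comm ∣ S ∖ v ∣ 1 ⟩
  suc ∣ S ∖ v ∣       ∎
  where open ≡-Reasoning

count-positive : (S : Subset N) (v : Fin N) → S v ≡ true → 0 <ℕ ∣ S ∣
count-positive S v v∈S = subst (0 <ℕ_) (sym (count-remove S v v∈S)) (s≤s z≤n)

count-witness : (S : Subset N) → 0 <ℕ ∣ S ∣ → ∃[ v ] S v ≡ true
count-witness S pos = let v , pos-v = sum-positive (𝟙 ∘ S) pos in v , indicator-positive pos-v

count-all : ∣ (λ (_ : Fin N) → true) ∣ ≡ N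
count-all {zero}  = refl
count-all {suc N} = cong suc (count-all {N})

count-insert : (S : Subset N) (x : Fin N) → S x ≡ false → ∣ insert x S ∣ ≡ suc ∣ S ∣
count-insert S x x∉S = begin
  ∣ insert x S ∣         ≡⟨ count-remove (insert x S) x (insert-here x S) ⟩
  suc ∣ insert x S ∖ x ∣ ≡⟨ cong suc (sum-cong-≗ (cong 𝟙 ∘ remove-insert)) ⟩
  suc ∣ S ∣              ∎
  where
  open ≡-Reasoning
  remove-insert : ∀ u → (insert x S ∖ x) u ≡ S u
  remove-insert u with u Fin.≟ x
  ... | yes refl rewrite x∉S = refl
  ... | no  _    = trans (Bool.∧-identityʳ _) (Bool.∨-identityʳ (S u))

-- keep b x is x for b = true and not x for b = false, i.e. it says x ≡ b
keep : Bool → Bool → Bool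
keep b x = if b then x else not x

keep-sound : (b x : Bool) → keep b x ≡ true → x ≡ b
keep-sound true  true  _ = refl
keep-sound false false _ = refl

keep-sym : (a b : Bool) → keep a b ≡ keep b a
keep-sym true  true  = refl
keep-sym true  false = refl
keep-sym false true  = refl
keep-sym false false = refl

keep-not : (a b : Bool) → keep (not a) b ≡ not (keep a b)
keep-not true  true  = refl
keep-not true  false = refl
keep-not false true  = refl
keep-not false false = refl

+-twice : (a x : ℕ) → a + x + x ≡ a + 2 * x
+-twice a x = trans (+-assoc a x x) (cong (λ y → a + (x + y)) (sym (+-identityʳ x)))

larger-half : (a b : ℕ) → ∃[ c ] a + b ≤ 2 * (if c then a else b)
larger-half a b with b ≤? a
... | yes b≤a = true  , ≤-trans (+-monoʳ-≤ a b≤a) (≤-reflexive (+-twice 0 a))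
... | no  b≰a = false , ≤-trans (+-monoˡ-≤ b (<⇒≤ (≰⇒> b≰a))) (≤-reflexive (+-twice 0 b))

majority : (f : Fin N → ℕ) (g : Bool → Fin N → ℕ) →
  (∀ i → f i ≡ g true i + g false i) → ∃[ b ] sum f ≤ 2 * sum (g b)
majority f g split with larger-half (sum (g true)) (sum (g false))
... | c , half = c , ≤-trans (≤-reflexive total) (≤-trans half (*-monoʳ-≤ 2 (≤-reflexive (part c))))
  where
  total : sum f ≡ sum (g true) + sum (g false)
  total = trans (sum-cong-≗ split) (∑-distrib-+ (g true) (g false))
  part : ∀ c → (if c then sum (g true) else sum (g false)) ≡ sum (g c)
  part true  = refl
  part false = refl

indicator-split : (s p : Bool) → 𝟙 s ≡ 𝟙 (s ∧ keep true p) + 𝟙 (s ∧ keep false p)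
indicator-split true  true  = refl
indicator-split true  false = refl
indicator-split false _     = refl

count-split : (S P : Subset N) →
  ∣ S ∣ ≡ ∣ (λ v → S v ∧ keep true (P v)) ∣ + ∣ (λ v → S v ∧ keep false (P v)) ∣
count-split S P = trans (sum-cong-≗ (λ v → indicator-split (S v) (P v)))
  (∑-distrib-+ (λ v → 𝟙 (S v ∧ keep true (P v))) (λ v → 𝟙 (S v ∧ keep false (P v))))

count-majority : (S P : Subset N) → ∃[ b ] ∣ S ∣ ≤ 2 * ∣ (λ v → S v ∧ keep b (P v)) ∣
count-majority S P =
  majority (𝟙 ∘ S) (λ b v → 𝟙 (S v ∧ keep b (P v))) (λ v → indicator-split (S v) (P v))

EdgeSet : ℕ → Set
EdgeSet N = Fin N → Fin N → Bool

-- W E = Σ_u |E(u)|, twice the number of edges when E is symmetric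
W : EdgeSet N → ℕ
W E = sum (λ u → ∣ E u ∣)

edge-majority : (E P : EdgeSet N) → ∃[ b ] W E ≤ 2 * W (λ u w → E u w ∧ keep b (P u w))
edge-majority E P =
  majority (λ u → ∣ E u ∣) (λ b u → ∣ (λ w → E u w ∧ keep b (P u w)) ∣) (λ u → count-split (E u) (P u))

-- the degree of v into S, and the (doubled) number of E-edges inside S
deg : EdgeSet N → Subset N → Fin N → ℕ
deg E S v = ∣ (λ w → S w ∧ E v w) ∣

inside : EdgeSet N → Subset N → Fin N → Fin N → ℕ
inside E S u w = 𝟙 (S u ∧ (S w ∧ E u w))

mass : EdgeSet N → Subset N → ℕ
mass E S = Σ² (inside E S)

mass-positive : (E : EdgeSet N) (S : Subset N) → 0 <ℕ mass E S → ∃[ v ] S v ≡ true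
mass-positive E S pos with sum-positive (λ u → sum (inside E S u)) pos
... | u , pos-u with sum-positive (inside E S u) pos-u
... | w , pos-uw = u , proj₁ (∧-true (indicator-positive pos-uw))

record DenseCore (E : EdgeSet N) (c : ℕ) (S : Subset N) : Set where
  field
    vertices   : Subset N
    inside-of  : vertices ⊆ S
    nonempty   : 0 <ℕ ∣ vertices ∣
    min-degree : ∀ v → vertices v ≡ true → c <ℕ deg E vertices v

module _ (E : EdgeSet N) (E-sym : ∀ u w → E u w ≡ E w u) (E-loopless : ∀ v → E v v ≡ false) where

  mass-remove : (S : Subset N) (v : Fin N) → S v ≡ true →
                mass E S ≡ mass E (S ∖ v) + 2 * deg E S v
  mass-remove S v v∈S = begin
    mass E S                                   ≡⟨ trans (+-identityʳ _) (+-identityʳ _) ⟨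
    mass E S + 0 + 0                           ≡⟨ cong₂ (λ r c → mass E S + r + c) row-gone col-gone ⟨
    mass E S + row g v + col g v               ≡⟨ cross-exchange v f g off diag ⟩
    mass E (S ∖ v) + row f v + col f v         ≡⟨ cong₂ (λ r c → mass E (S ∖ v) + r + c) row-deg col-deg ⟩
    mass E (S ∖ v) + deg E S v + deg E S v     ≡⟨ +-twice (mass E (S ∖ v)) (deg E S v) ⟩
    mass E (S ∖ v) + 2 * deg E S v             ∎
    where
    open ≡-Reasoning
    f g : Fin N → Fin N → ℕ
    f = inside E S
    g = inside E (S ∖ v)
    off : ∀ u w → u ≢ v → w ≢ v → f u w ≡ g u w
    off u w u≢v w≢v = cong₂ (λ a b → 𝟙 (a ∧ (b ∧ E u w))) (sym (∖-other S u≢v)) (sym (∖-other S w≢v))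
    diag : f v v ≡ g v v
    diag rewrite ∖-self S v | v∈S | E-loopless v = refl
    row-gone : row g v ≡ 0
    row-gone = trans (sum-cong-≗ (λ w → cong (λ a → 𝟙 (a ∧ ((S ∖ v) w ∧ E v w))) (∖-self S v)))
                     (sum-zero {N})
    col-gone : col g v ≡ 0
    col-gone = trans (sum-cong-≗ (λ u → trans (cong (λ a → 𝟙 ((S ∖ v) u ∧ (a ∧ E u v))) (∖-self S v))
                                              (cong 𝟙 (Bool.∧-zeroʳ ((S ∖ v) u))))) (sum-zero {N})
    row-deg : row f v ≡ deg E S v
    row-deg = sum-cong-≗ (λ w → cong (λ a → 𝟙 (a ∧ (S w ∧ E v w))) v∈S)
    col-deg : col f v ≡ deg E S v
    col-deg = sum-cong-≗ (λ u → cong₂ (λ a b → 𝟙 (S u ∧ (a ∧ b))) v∈S (E-sym u v))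

  remove-sparse-vertex : (c : ℕ) (S : Subset N) (v : Fin N) → S v ≡ true → deg E S v ≤ c →
    2 * c * ∣ S ∣ <ℕ mass E S → 2 * c * ∣ S ∖ v ∣ <ℕ mass E (S ∖ v)
  remove-sparse-vertex c S v v∈S low dense = +-cancelʳ-< (2 * c) _ _ (begin-strict
    2 * c * ∣ S ∖ v ∣ + 2 * c      ≡⟨ +-comm _ (2 * c) ⟩
    2 * c + 2 * c * ∣ S ∖ v ∣      ≡⟨ *-suc (2 * c) _ ⟨
    2 * c * suc ∣ S ∖ v ∣          ≡⟨ cong (2 * c *_) (count-remove S v v∈S) ⟨
    2 * c * ∣ S ∣                  <⟨ dense ⟩
    mass E S                       ≡⟨ mass-remove S v v∈S ⟩
    mass E (S ∖ v) + 2 * deg E S v ≤⟨ +-monoʳ-≤ (mass E (S ∖ v)) (*-monoʳ-≤ 2 low) ⟩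
    mass E (S ∖ v) + 2 * c         ∎)
    where open ≤-Reasoning

  -- Core lemma: if 2c|S| < mass E S, deleting vertices of degree at most c
  -- one by one ends in a nonempty S' ⊆ S of minimum degree above c.
  dense-core : (c : ℕ) (S : Subset N) → 2 * c * ∣ S ∣ <ℕ mass E S → DenseCore E c S
  dense-core c S = peel ∣ S ∣ S ≤-refl
    where
    peel : (k : ℕ) (S : Subset N) → ∣ S ∣ ≤ k → 2 * c * ∣ S ∣ <ℕ mass E S → DenseCore E c S
    peel k S size dense with any? (λ v → (S v Bool.≟ true) ×-dec (deg E S v ≤? c))
    ... | no none = record
      { vertices = S ; inside-of = λ _ v∈S → v∈S
      ; nonempty = let v , v∈S = mass-positive E S (≤-trans (s≤s z≤n) dense) in count-positive S v v∈S
      ; min-degree = λ v v∈S → ≰⇒> (λ low → none (v , v∈S , low)) }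
    ... | yes (v , v∈S , low) with k
    ...   | zero  = contradiction (≤-trans (count-positive S v v∈S) size) λ ()
    ...   | suc k = shrink (peel k (S ∖ v) size′ (remove-sparse-vertex c S v v∈S low dense))
      where
      size′ : ∣ S ∖ v ∣ ≤ k
      size′ = ≤-pred (subst (_≤ suc k) (count-remove S v v∈S) size)
      shrink : DenseCore E c (S ∖ v) → DenseCore E c S
      shrink K = record { vertices = vertices ; inside-of = λ u u∈K → proj₁ (∧-true (inside-of u u∈K))
                        ; nonempty = nonempty ; min-degree = min-degree }
        where open DenseCore K

  core-of-average : (c : ℕ) (S : Subset N) → 0 <ℕ ∣ S ∣ → 2 * suc c * ∣ S ∣ ≤ mass E S → DenseCore E c S
  core-of-average c S pos dense =
    dense-core c S (<-≤-trans (*-monoˡ-< ∣ S ∣ {{>-nonZero pos}} (*-monoʳ-< 2 (n<1+n c))) dense)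

cut : EdgeSet N → (Fin N → Bool) → EdgeSet N
cut E s u w = E u w ∧ not (keep (s u) (s w))

cut-sides : (E : EdgeSet N) (s : Fin N → Bool) (u w : Fin N) → cut E s u w ≡ true → s u ≢ s w
cut-sides E s u w uw∈cut su≡sw =
  not-keep-self (s w) (subst (λ a → not (keep a (s w)) ≡ true) su≡sw (proj₂ (∧-true {E u w} uw∈cut)))
  where
  not-keep-self : ∀ a → not (keep a a) ≢ true
  not-keep-self true  ()
  not-keep-self false ()

module _ (E : EdgeSet N) (E-sym : ∀ u w → E u w ≡ E w u) (E-loopless : ∀ v → E v v ≡ false) where

  mono : (Fin N → Bool) → Fin N → Fin N → ℕ
  mono s u w = 𝟙 (E u w ∧ keep (s u) (s w))

  same : (Fin N → Bool) → Fin N → ℕ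
  same s = row (mono s)

  mono-sym : (s : Fin N → Bool) (u w : Fin N) → mono s u w ≡ mono s w u
  mono-sym s u w = cong₂ (λ a b → 𝟙 (a ∧ b)) (E-sym u w) (keep-sym (s u) (s w))

  recolour : (Fin N → Bool) → Fin N → Fin N → Bool
  recolour s v u = if does (u Fin.≟ v) then not (s u) else s u

  -- Recolouring v turns its monochromatic edges into cut edges and vice versa.
  recolour-exchange : (s : Fin N → Bool) (v : Fin N) →
    Σ² (mono (recolour s v)) + 2 * same s v ≡ Σ² (mono s) + 2 * ∣ cut E s v ∣
  recolour-exchange s v = begin
    Σ² (mono s′) + 2 * same s v
      ≡⟨ +-twice (Σ² (mono s′)) (same s v) ⟨
    Σ² (mono s′) + same s v + same s v
      ≡⟨ cong (Σ² (mono s′) + same s v +_) (sum-cong-≗ (mono-sym s v)) ⟩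
    Σ² (mono s′) + row (mono s) v + col (mono s) v
      ≡⟨ cross-exchange v (mono s′) (mono s) off diag ⟩
    Σ² (mono s) + row (mono s′) v + col (mono s′) v
      ≡⟨ cong (Σ² (mono s) + row (mono s′) v +_) (sum-cong-≗ (λ u → mono-sym s′ u v)) ⟩
    Σ² (mono s) + row (mono s′) v + row (mono s′) v
      ≡⟨ cong (λ x → Σ² (mono s) + x + x) (sum-cong-≗ row-flipped) ⟩
    Σ² (mono s) + ∣ cut E s v ∣ + ∣ cut E s v ∣
      ≡⟨ +-twice (Σ² (mono s)) ∣ cut E s v ∣ ⟩
    Σ² (mono s) + 2 * ∣ cut E s v ∣ ∎
    where
    open ≡-Reasoning
    s′ : Fin N → Bool
    s′ = recolour s v
    unchanged : ∀ {u} → u ≢ v → s′ u ≡ s u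
    unchanged {u} u≢v with u Fin.≟ v
    ... | yes u≡v = contradiction u≡v u≢v
    ... | no  _   = refl
    off : ∀ u w → u ≢ v → w ≢ v → mono s′ u w ≡ mono s u w
    off u w u≢v w≢v = cong₂ (λ a b → 𝟙 (E u w ∧ keep a b)) (unchanged u≢v) (unchanged w≢v)
    diag : mono s′ v v ≡ mono s v v
    diag rewrite E-loopless v = refl
    flipped : s′ v ≡ not (s v)
    flipped with v Fin.≟ v
    ... | yes _  = refl
    ... | no v≢v = contradiction refl v≢v
    row-flipped : ∀ w → mono s′ v w ≡ 𝟙 (cut E s v w)
    row-flipped w with w Fin.≟ v
    ... | yes refl rewrite E-loopless w = refl
    ... | no  w≢v  = cong (λ b → 𝟙 (E v w ∧ b))
                       (trans (cong (λ a → keep a (s w)) flipped) (keep-not (s v) (s w)))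

  -- Local search: recolouring a vertex with more neighbours on its own side
  -- strictly decreases the number of monochromatic edges, so it terminates
  -- in a colouring where every vertex has at least half its neighbours across.
  locally-maximal-cut : Σ (Fin N → Bool) λ s → ∀ v → same s v ≤ ∣ cut E s v ∣
  locally-maximal-cut = search _ (λ _ → false) ≤-refl
    where
    search : (k : ℕ) (s : Fin N → Bool) → Σ² (mono s) ≤ k →
             Σ (Fin N → Bool) λ s → ∀ v → same s v ≤ ∣ cut E s v ∣
    search k s bound with any? (λ v → ∣ cut E s v ∣ <? same s v)
    ... | no none = s , λ v → ≮⇒≥ (λ lt → none (v , lt))
    ... | yes (v , lt) = continue k bound
      where
      decrease : Σ² (mono (recolour s v)) <ℕ Σ² (mono s)
      decrease = +-cancelʳ-< (2 * same s v) _ _ (begin-strict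
        Σ² (mono (recolour s v)) + 2 * same s v ≡⟨ recolour-exchange s v ⟩
        Σ² (mono s) + 2 * ∣ cut E s v ∣         <⟨ +-monoʳ-< (Σ² (mono s)) (*-monoʳ-< 2 lt) ⟩
        Σ² (mono s) + 2 * same s v              ∎)
        where open ≤-Reasoning
      continue : (k : ℕ) → Σ² (mono s) ≤ k → Σ (Fin N → Bool) λ s → ∀ v → same s v ≤ ∣ cut E s v ∣
      continue zero    bound = contradiction (≤-trans decrease bound) λ ()
      continue (suc k) bound = search k (recolour s v) (≤-pred (≤-trans decrease bound))

  large-cut : Σ (Fin N → Bool) λ s → W E ≤ 2 * W (cut E s)
  large-cut = s , (begin
    sum (λ v → ∣ E v ∣)
      ≡⟨ sum-cong-≗ (λ v → count-split (E v) (λ w → keep (s v) (s w))) ⟩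
    sum (λ v → same s v + ∣ cut E s v ∣)
      ≤⟨ sum-mono (λ v → +-monoˡ-≤ _ (half-across v)) ⟩
    sum (λ v → ∣ cut E s v ∣ + ∣ cut E s v ∣)
      ≡⟨ sum-cong-≗ (λ v → +-twice 0 ∣ cut E s v ∣) ⟩
    sum (λ v → 2 * ∣ cut E s v ∣)
      ≡⟨ *-distribˡ-sum 2 (λ v → ∣ cut E s v ∣) ⟨
    2 * W (cut E s) ∎)
    where
    open ≤-Reasoning
    s : Fin N → Bool
    s = proj₁ locally-maximal-cut
    half-across : ∀ v → same s v ≤ ∣ cut E s v ∣
    half-across = proj₂ locally-maximal-cut

_<[_]_ : {A : Set} → A → LinearOrder A → A → Set
x <[ L ] y = _<_ L x y

reverse : {A : Set} → LinearOrder A → LinearOrder A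
reverse L = record { _<_ = λ x y → y <[ L ] x ; isSTO = Flip.isStrictTotalOrder (isSTO L) }

orient : {A : Set} → Bool → LinearOrder A → LinearOrder A
orient true  L = L
orient false L = reverse L

pullback : {A B : Set} (f : B → A) → Injective _≡_ _≡_ f → LinearOrder A → LinearOrder B
pullback {A} {B} f f-inj L = record { _<_ = λ x y → f x <[ L ] f y ; isSTO = sto }
  where
  module L = IsStrictTotalOrder (isSTO L)
  compare : ∀ x y → Tri (f x <[ L ] f y) (x ≡ y) (f y <[ L ] f x)
  compare x y with L.compare (f x) (f y)
  ... | tri< a ¬b ¬c = tri< a (¬b ∘ cong f) ¬c
  ... | tri≈ ¬a b ¬c = tri≈ ¬a (f-inj b) ¬c
  ... | tri> ¬a ¬b c = tri> ¬a (¬b ∘ cong f) c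
  sto : IsStrictTotalOrder _≡_ (λ x y → f x <[ L ] f y)
  sto = record
    { isStrictPartialOrder = record
      { isEquivalence = isEquivalence
      ; irrefl        = λ x≡y → L.irrefl (cong f x≡y)
      ; trans         = L.trans
      ; <-resp-≈      = (λ { refl p → p }) , (λ { refl p → p }) }
    ; compare = compare }

precedes : {A : Set} → LinearOrder A → A → A → Bool
precedes L x y = does (IsStrictTotalOrder._<?_ (isSTO L) x y)

precedes-keep : {A : Set} (L : LinearOrder A) (b : Bool) {x y : A} →
  keep b (precedes L x y) ≡ true → x ≢ y → x <[ orient b L ] y
precedes-keep L true {x} {y} kept x≢y with IsStrictTotalOrder._<?_ (isSTO L) x y
... | yes x<y = x<y
precedes-keep L false {x} {y} kept x≢y with IsStrictTotalOrder._<?_ (isSTO L) x y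
... | no x≮y with IsStrictTotalOrder.compare (isSTO L) x y
...   | tri< x<y _ _ = contradiction x<y x≮y
...   | tri≈ _ x≡y _ = contradiction x≡y x≢y
...   | tri> _ _ y<x = y<x

module _ (side : Fin N → Bool) where

  Bipartite : EdgeSet N → Set
  Bipartite E = ∀ u w → E u w ≡ true → side u ≢ side w

  Increasing : EdgeSet N → LinearOrder (Fin N) → Set
  Increasing E L = ∀ v w → E v w ≡ true → side v ≡ false → side w ≡ true → v <[ L ] w

  false-end-first : LinearOrder (Fin N) → Fin N → Fin N → Bool
  false-end-first L u w = if side u then precedes L w u else precedes L u w

  false-end-first-sym : (L : LinearOrder (Fin N)) (u w : Fin N) → side u ≢ side w →
                        false-end-first L u w ≡ false-end-first L w u
  false-end-first-sym L u w sides with side u | side w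
  ... | true  | false = refl
  ... | false | true  = refl
  ... | true  | true  = contradiction refl sides
  ... | false | false = contradiction refl sides

  directed : EdgeSet N → LinearOrder (Fin N) → Bool → EdgeSet N
  directed E L b u w = E u w ∧ keep b (false-end-first L u w)

  module _ {E : EdgeSet N} (E-sym : ∀ u w → E u w ≡ E w u) (E-bip : Bipartite E) where

    directed-sym : (L : LinearOrder (Fin N)) (b : Bool) (u w : Fin N) →
                   directed E L b u w ≡ directed E L b w u
    directed-sym L b u w with E u w in uw∈E
    ... | true  = sym (cong₂ (λ e f → e ∧ keep b f) (trans (E-sym w u) uw∈E)
                        (false-end-first-sym L w u (λ eq → E-bip u w uw∈E (sym eq))))
    ... | false = sym (cong (λ e → e ∧ keep b (false-end-first L w u)) (trans (E-sym w u) uw∈E))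

    directed-increasing : (L : LinearOrder (Fin N)) (b : Bool) → Increasing (directed E L b) (orient b L)
    directed-increasing L b v w vw∈E′ v-false w-true with ∧-true {E v w} vw∈E′
    ... | vw∈E , kept rewrite v-false =
      precedes-keep L b kept (λ { refl → E-bip v v vw∈E refl })

  record Orientation (E : EdgeSet N) {k : ℕ} (R : Fin k → LinearOrder (Fin N)) : Set where
    field
      edges      : EdgeSet N
      sub        : ∀ u w → edges u w ≡ true → E u w ≡ true
      symmetric  : ∀ u w → edges u w ≡ edges w u
      heavy      : W E ≤ 2 ^ k * W edges
      signs      : Fin k → Bool
      increasing : ∀ i → Increasing edges (orient (signs i) (R i))

  -- Handle the orders one at a time, each time keeping the larger of the
  -- edges going up and the edges going down.
  orient-all : {k : ℕ} (R : Fin k → LinearOrder (Fin N)) {E : EdgeSet N} →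
    (∀ u w → E u w ≡ E w u) → Bipartite E → Orientation E R
  orient-all {zero} R {E} E-sym E-bip = record
    { edges = E ; sub = λ _ _ e → e ; symmetric = E-sym ; heavy = ≤-reflexive (sym (*-identityˡ (W E)))
    ; signs = λ () ; increasing = λ () }
  orient-all {suc k} R {E} E-sym E-bip = record
    { edges      = edges
    ; sub        = λ u w e → proj₁ (∧-true (sub u w e))
    ; symmetric  = symmetric
    ; heavy      = ≤-trans half (≤-trans (*-monoʳ-≤ 2 heavy) (≤-reflexive (sym (*-assoc 2 (2 ^ k) (W edges)))))
    ; signs      = λ { zero → b ; (suc i) → signs i }
    ; increasing = λ { zero v w e → directed-increasing E-sym E-bip (R zero) b v w (sub v w e)
                     ; (suc i) → increasing i } }
    where
    b : Bool
    b = proj₁ (edge-majority E (false-end-first (R zero)))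
    E₁ : EdgeSet N
    E₁ = directed E (R zero) b
    half : W E ≤ 2 * W E₁
    half = proj₂ (edge-majority E (false-end-first (R zero)))
    E₁-bip : Bipartite E₁
    E₁-bip u w e = E-bip u w (proj₁ (∧-true e))
    open Orientation (orient-all (R ∘ suc) (directed-sym E-sym E-bip (R zero) b) E₁-bip)

bipartite-loopless : {side : Fin N → Bool} {E : EdgeSet N} → Bipartite side E → ∀ v → E v v ≡ false
bipartite-loopless {E = E} bip v with E v v in vv∈E
... | false = refl
... | true  = contradiction refl (bip v v vv∈E)

Ordered : {A : Set} → LinearOrder A → Sign → A → A → Set
Ordered L Sign.+ x y = x <[ L ] y
Ordered L Sign.- x y = y <[ L ] x

module _ (L₁ L₂ : LinearOrder (Fin N)) where
  private
    module L₁ = IsStrictTotalOrder (isSTO L₁)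
    module L₂ = IsStrictTotalOrder (isSTO L₂)

  _≺_ : Fin N → Fin N → Set
  x ≺ y = x <[ L₁ ] y × x <[ L₂ ] y

  Monotone : Sign → Subset N → Set
  Monotone s Y = ∀ y y′ → Y y ≡ true → Y y′ ≡ true → y <[ L₁ ] y′ → Ordered L₂ s y y′

  record MonotoneSubset (X : Subset N) (r : ℕ) : Set where
    field
      members  : Subset N
      within   : members ⊆ X
      size     : r ≤ ∣ members ∣
      sign     : Sign
      monotone : Monotone sign members

  record Chain (X : Subset N) (k : ℕ) : Set where
    field
      members  : Subset N
      within   : members ⊆ X
      size     : k ≤ ∣ members ∣
      monotone : Monotone Sign.+ members
      least    : Fin N
      least∈   : members least ≡ true
      above    : ∀ y → members y ≡ true → y ≡ least ⊎ least ≺ y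

  dominated : Subset N → Fin N → Bool
  dominated X y = does (any? (λ x → (X x Bool.≟ true) ×-dec (x L₁.<? y ×-dec x L₂.<? y)))

  dominated-sound : (X : Subset N) (y : Fin N) → dominated X y ≡ true → ∃[ x ] X x ≡ true × x ≺ y
  dominated-sound X y dom with any? (λ x → (X x Bool.≟ true) ×-dec (x L₁.<? y ×-dec x L₂.<? y))
  ... | yes found = found

  dominated-complete : (X : Subset N) (y : Fin N) → ∃[ x ] X x ≡ true × x ≺ y → dominated X y ≡ true
  dominated-complete X y found with any? (λ x → (X x Bool.≟ true) ×-dec (x L₁.<? y ×-dec x L₂.<? y))
  ... | yes _   = refl
  ... | no none = contradiction found none

  minimal upper : Subset N → Subset N
  minimal X y = X y ∧ not (dominated X y)
  upper   X y = X y ∧ dominated X y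

  -- the minimal elements form an antichain of ≺, i.e. a decreasing set
  minimal-decreasing : (X : Subset N) → Monotone Sign.- (minimal X)
  minimal-decreasing X y y′ y∈M y′∈M y<₁y′ with L₂.compare y y′
  ... | tri< y<₂y′ _ _ = contradiction (dominated-complete X y′ (y , proj₁ (∧-true y∈M) , y<₁y′ , y<₂y′))
                                       (not-true (proj₂ (∧-true {X y′} y′∈M)))
    where
    not-true : ∀ {b} → not b ≡ true → b ≢ true
    not-true {false} _ ()
  ... | tri≈ _ y≡y′ _  = contradiction y≡y′ (λ eq → L₁.irrefl eq y<₁y′)
  ... | tri> _ _ y′<₂y = y′<₂y

  singleton-chain : (X : Subset N) (c : Fin N) → X c ≡ true → Chain X 1
  singleton-chain X c c∈X = record
    { members  = λ y → does (y Fin.≟ c)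
    ; within   = λ y y≡c → subst (λ z → X z ≡ true) (sym (≟-sound y≡c)) c∈X
    ; size     = count-positive _ c (≟-refl c)
    ; monotone = λ y y′ y≡c y′≡c y<y′ → contradiction (trans (≟-sound y≡c) (sym (≟-sound y′≡c)))
                                                      (λ eq → L₁.irrefl eq y<y′)
    ; least    = c
    ; least∈   = ≟-refl c
    ; above    = λ y y≡c → inj₁ (≟-sound y≡c) }

  extend-chain : {X Y : Subset N} {k : ℕ} → Y ⊆ X → (C : Chain Y k) (x : Fin N) → X x ≡ true →
    x ≺ Chain.least C → Chain X (suc k)
  extend-chain {X} {Y} {k} Y⊆X C x x∈X x≺c = record
    { members  = insert x members
    ; within   = λ y y∈ → [ (λ y∈C → Y⊆X y (within y y∈C)) , (λ { refl → x∈X }) ]′ (cases y y∈)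
    ; size     = subst (suc k ≤_) (sym (count-insert members x x∉C)) (s≤s size)
    ; monotone = monotone′
    ; least    = x
    ; least∈   = insert-here x members
    ; above    = λ y y∈ → [ (λ y∈C → inj₂ (below y y∈C)) , inj₁ ]′ (cases y y∈) }
    where
    open Chain C
    below : ∀ y → members y ≡ true → x ≺ y
    below y y∈C with above y y∈C
    ... | inj₁ refl          = x≺c
    ... | inj₂ (c<₁y , c<₂y) = L₁.trans (proj₁ x≺c) c<₁y , L₂.trans (proj₂ x≺c) c<₂y
    x∉C : members x ≡ false
    x∉C with members x in x∈C
    ... | false = refl
    ... | true  = contradiction (proj₁ (below x x∈C)) (L₁.irrefl refl)
    cases : ∀ y → insert x members y ≡ true → members y ≡ true ⊎ y ≡ x
    cases y y∈ = map₂ ≟-sound (∨-true y∈)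
    monotone′ : Monotone Sign.+ (insert x members)
    monotone′ y y′ y∈ y′∈ y<y′ with cases y y∈ | cases y′ y′∈
    ... | inj₁ y∈C  | inj₁ y′∈C = monotone y y′ y∈C y′∈C y<y′
    ... | inj₂ refl | inj₁ y′∈C = proj₂ (below y′ y′∈C)
    ... | inj₁ y∈C  | inj₂ refl = contradiction (proj₁ (below y y∈C)) (L₁.asym y<y′)
    ... | inj₂ refl | inj₂ refl = contradiction y<y′ (L₁.irrefl refl)

  no-monotone : {X : Subset N} → MonotoneSubset X 0
  no-monotone = record { members = λ _ → false ; within = λ _ () ; size = z≤n
                       ; sign = Sign.+ ; monotone = λ _ _ () }

  chain-monotone : {X : Subset N} {k : ℕ} → Chain X k → MonotoneSubset X k
  chain-monotone C = record { members = members ; within = within ; size = size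
                            ; sign = Sign.+ ; monotone = monotone }
    where open Chain C

  monotone-⊆ : {X Y : Subset N} {r : ℕ} → Y ⊆ X → MonotoneSubset Y r → MonotoneSubset X r
  monotone-⊆ Y⊆X M = record { members = members ; within = λ y y∈ → Y⊆X y (within y y∈)
                            ; size = size ; sign = sign ; monotone = monotone }
    where open MonotoneSubset M

  -- Peel off the ≺-minimal elements of X layer by layer: if k r < |X|, then
  -- some layer is an antichain of more than r elements or there is a chain of
  -- k + 1 elements, built downwards from the last layer.
  layers : (r k : ℕ) (X : Subset N) → k * r <ℕ ∣ X ∣ → MonotoneSubset X (suc r) ⊎ Chain X (suc k)
  layers r zero X big = let c , c∈X = count-witness X big in inj₂ (singleton-chain X c c∈X)
  layers r (suc k) X big with suc r ≤? ∣ minimal X ∣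
  ... | yes wide = inj₁ (record { members = minimal X ; within = λ y y∈ → proj₁ (∧-true y∈)
                               ; size = wide ; sign = Sign.- ; monotone = minimal-decreasing X })
  ... | no narrow with layers r k (upper X) big′
    where
    big′ : k * r <ℕ ∣ upper X ∣
    big′ = +-cancelˡ-< r _ _ (begin-strict
      r + k * r                     <⟨ big ⟩
      ∣ X ∣                         ≡⟨ count-split X (dominated X) ⟩
      ∣ upper X ∣ + ∣ minimal X ∣   ≤⟨ +-monoʳ-≤ ∣ upper X ∣ (≤-pred (≰⇒> narrow)) ⟩
      ∣ upper X ∣ + r               ≡⟨ +-comm ∣ upper X ∣ r ⟩
      r + ∣ upper X ∣               ∎)
      where open ≤-Reasoning
  ... | inj₁ M = inj₁ (monotone-⊆ (λ y y∈ → proj₁ (∧-true y∈)) M)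
  ... | inj₂ C = inj₂ (extend-chain (λ y y∈ → proj₁ (∧-true y∈)) C x x∈X x≺c)
    where
    open Chain C using (least; least∈; within)
    dominated-least : ∃[ x ] X x ≡ true × x ≺ least
    dominated-least = dominated-sound X least (proj₂ (∧-true (within least least∈)))
    x : Fin N
    x = proj₁ dominated-least
    x∈X : X x ≡ true
    x∈X = proj₁ (proj₂ dominated-least)
    x≺c : x ≺ least
    x≺c = proj₂ (proj₂ dominated-least)

  erdos-szekeres : (r : ℕ) (X : Subset N) → r * r ≤ ∣ X ∣ → MonotoneSubset X r
  erdos-szekeres zero X _ = no-monotone
  erdos-szekeres (suc r) X big with layers r r X (<-≤-trans (*-mono-< (n<1+n r) (n<1+n r)) big)
  ... | inj₁ M = M
  ... | inj₂ C = chain-monotone C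

  monotone-sub : {s : Sign} {Y Z : Subset N} → Z ⊆ Y → Monotone s Y → Monotone s Z
  monotone-sub Z⊆Y mono y y′ y∈ y′∈ = mono y y′ (Z⊆Y y y∈) (Z⊆Y y′ y′∈)

is-plus : Sign → Bool
is-plus Sign.+ = true
is-plus Sign.- = false

sign-of : Bool → Sign
sign-of true  = Sign.+
sign-of false = Sign.-

keep-is-plus : (b : Bool) (s : Sign) → keep b (is-plus s) ≡ true → s ≡ sign-of b
keep-is-plus true  Sign.+ _ = refl
keep-is-plus false Sign.- _ = refl

-- x^(2^(e+1)) = (x^(2^e))²: one application of Erdős–Szekeres halves the exponent
^-square : (x e : ℕ) → x ^ (2 ^ suc e) ≡ x ^ (2 ^ e) * x ^ (2 ^ e)
^-square x e = trans (cong (λ m → x ^ (2 ^ e + m)) (+-identityʳ (2 ^ e))) (^-distribˡ-+-* x (2 ^ e) (2 ^ e))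

module _ (L₀ : LinearOrder (Fin N)) (x : ℕ) where

  record Homogenised (A : Subset N) (X : Fin N → Subset N) {k : ℕ}
                     (R : Fin k → LinearOrder (Fin N)) : Set where
    field
      centres     : Subset N
      centres⊆    : centres ⊆ A
      many        : ∣ A ∣ ≤ 2 ^ k * ∣ centres ∣
      nbhd        : Fin N → Subset N
      nbhd⊆       : ∀ v → centres v ≡ true → nbhd v ⊆ X v
      large       : ∀ v → centres v ≡ true → x ≤ ∣ nbhd v ∣
      signs       : Fin k → Sign
      homogeneous : ∀ v → centres v ≡ true → ∀ i → Monotone L₀ (R i) (signs i) (nbhd v)

  -- Apply Erdős–Szekeres to the candidates of every centre, one order at a time,
  -- and keep the centres with the majority sign.
  homogenise : {k : ℕ} (R : Fin k → LinearOrder (Fin N)) (A : Subset N) (X : Fin N → Subset N) →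
    (∀ v → A v ≡ true → x ^ (2 ^ k) ≤ ∣ X v ∣) → Homogenised A X R
  homogenise {zero} R A X big = record
    { centres = A ; centres⊆ = λ _ v∈A → v∈A ; many = ≤-reflexive (sym (*-identityˡ ∣ A ∣))
    ; nbhd = X ; nbhd⊆ = λ _ _ _ w∈ → w∈
    ; large = λ v v∈A → subst (_≤ ∣ X v ∣) (^-identityʳ x) (big v v∈A)
    ; signs = λ () ; homogeneous = λ _ _ () }
  homogenise {suc k} R A X big = record
    { centres     = centres
    ; centres⊆    = λ v v∈ → proj₁ (∧-true (centres⊆ v v∈))
    ; many        = ≤-trans half (≤-trans (*-monoʳ-≤ 2 many) (≤-reflexive (sym (*-assoc 2 (2 ^ k) ∣ centres ∣))))
    ; nbhd        = nbhd
    ; nbhd⊆       = λ v v∈ w w∈ → MonotoneSubset.within (pick v) w (nbhd⊆ v v∈ w w∈)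
    ; large       = large
    ; signs       = λ { zero → sign-of b ; (suc i) → signs i }
    ; homogeneous = λ { v v∈ zero → first v v∈ ; v v∈ (suc i) → homogeneous v v∈ i } }
    where
    r : ℕ
    r = x ^ (2 ^ k)
    pick : ∀ v → MonotoneSubset L₀ (R zero) (X v) (if A v then r else 0)
    pick v with A v in v∈A
    ... | true  = erdos-szekeres L₀ (R zero) r (X v) (subst (_≤ ∣ X v ∣) (^-square x k) (big v v∈A))
    ... | false = no-monotone L₀ (R zero)
    b : Bool
    b = proj₁ (count-majority A (λ v → is-plus (MonotoneSubset.sign (pick v))))
    A₁ : Subset N
    A₁ v = A v ∧ keep b (is-plus (MonotoneSubset.sign (pick v)))
    half : ∣ A ∣ ≤ 2 * ∣ A₁ ∣
    half = proj₂ (count-majority A (λ v → is-plus (MonotoneSubset.sign (pick v))))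
    big₁ : ∀ v → A₁ v ≡ true → r ≤ ∣ MonotoneSubset.members (pick v) ∣
    big₁ v v∈ = subst (λ a → (if a then r else 0) ≤ ∣ MonotoneSubset.members (pick v) ∣)
                      (proj₁ (∧-true v∈)) (MonotoneSubset.size (pick v))
    open Homogenised (homogenise (R ∘ suc) A₁ (MonotoneSubset.members ∘ pick) big₁)
    first : ∀ v → centres v ≡ true → Monotone L₀ (R zero) (sign-of b) (nbhd v)
    first v v∈ = subst (λ s → Monotone L₀ (R zero) s (nbhd v))
                       (keep-is-plus b _ (proj₂ (∧-true (centres⊆ v v∈))))
                       (monotone-sub L₀ (R zero) {MonotoneSubset.sign (pick v)} (nbhd⊆ v v∈)
                                     (MonotoneSubset.monotone (pick v)))

length-filter-tabulate : {m : ℕ} {B : Set} (g : Fin m → B) (p : B → Bool) →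
  length (filter (λ y → p y Bool.≟ true) (tabulate g)) ≡ sum (λ j → 𝟙 (p (g j)))
length-filter-tabulate {zero}  g p = refl
length-filter-tabulate {suc m} g p with p (g zero)
... | true  = cong suc (length-filter-tabulate (g ∘ suc) p)
... | false = length-filter-tabulate (g ∘ suc) p

sum-map-tabulate : {m : ℕ} {B : Set} (g : Fin m → B) (h : B → ℕ) →
  ListSum.sum (map h (tabulate g)) ≡ sum (h ∘ g)
sum-map-tabulate {zero}  g h = refl
sum-map-tabulate {suc m} g h = cong (h (g zero) +_) (sum-map-tabulate (g ∘ suc) h)

degree≡ : (G : Graph) (v : Fin (n G)) → degree G v ≡ ∣ adj G v ∣
degree≡ G v = length-filter-tabulate (λ w → w) (adj G v)

degreeSum≡ : (G : Graph) → degreeSum G ≡ W (adj G)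
degreeSum≡ G = trans (sum-map-tabulate (λ v → v) (degree G)) (sum-cong-≗ (degree≡ G))

mutual
  enum : (S : Subset N) → Fin ∣ S ∣ → Fin N
  enum {suc N} S = enum-from (S zero) (S ∘ suc)

  enum-from : (b : Bool) (S : Subset N) → Fin (𝟙 b + ∣ S ∣) → Fin (suc N)
  enum-from true  S zero    = zero
  enum-from true  S (suc j) = suc (enum S j)
  enum-from false S j       = suc (enum S j)

mutual
  enum-member : (S : Subset N) (j : Fin ∣ S ∣) → S (enum S j) ≡ true
  enum-member {suc N} S = enum-from-member S (S zero) refl

  enum-from-member : (S : Subset (suc N)) (b : Bool) → S zero ≡ b →
    (j : Fin (𝟙 b + ∣ S ∘ suc ∣)) → S (enum-from b (S ∘ suc) j) ≡ true
  enum-from-member S true  first zero    = first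
  enum-from-member S true  _     (suc j) = enum-member (S ∘ suc) j
  enum-from-member S false _     j       = enum-member (S ∘ suc) j

mutual
  enum-injective : (S : Subset N) → Injective _≡_ _≡_ (enum S)
  enum-injective {suc N} S = enum-from-injective (S zero) (S ∘ suc)

  enum-from-injective : (b : Bool) (S : Subset N) → Injective _≡_ _≡_ (enum-from b S)
  enum-from-injective true  S {zero}  {zero}  _  = refl
  enum-from-injective true  S {suc i} {suc j} eq = cong suc (enum-injective S (fsuc-injective eq))
  enum-from-injective false S                 eq = enum-injective S (fsuc-injective eq)

mutual
  sum-enum : (S : Subset N) (g : Fin N → ℕ) → sum (g ∘ enum S) ≡ sum (λ w → if S w then g w else 0)
  sum-enum {zero}  S g = refl
  sum-enum {suc N} S g = sum-enum-from (S zero) (S ∘ suc) g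

  sum-enum-from : (b : Bool) (S : Subset N) (g : Fin (suc N) → ℕ) →
    sum (g ∘ enum-from b S) ≡ (if b then g zero else 0) + sum (λ w → if S w then g (suc w) else 0)
  sum-enum-from true  S g = cong (g zero +_) (sum-enum S (g ∘ suc))
  sum-enum-from false S g = sum-enum S (g ∘ suc)

HomogeneousSubgraph : (d t : ℕ) (G : Graph) → Set₁
HomogeneousSubgraph d t G =
  Σ Graph λ G' → 1 ≤ n G' ×
    Σ (Fin (n G') → Fin (n G)) λ f → SubgraphVia G' G f ×
    Σ (Fin (n G') → Bool) λ side → IsBipartition G' side ×
    MinDegreeAtLeast G' t ×
    Σ (Representation G' d) λ R →
      Separating G' R × Consistent G' side R ×
      (Homogeneous G' side false R ⊎ Homogeneous G' side true R)

record Skeleton (G : Graph) (d c : ℕ) : Set₁ where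
  field
    edges       : EdgeSet (n G)
    edges⊆      : ∀ u w → edges u w ≡ true → Edge G u w
    symmetric   : ∀ u w → edges u w ≡ edges w u
    side        : Fin (n G) → Bool
    bipartite   : Bipartite side edges
    orders      : Representation G d
    separating  : Separating G orders
    increasing  : ∀ i → Increasing side edges (orders i)
    core        : Subset (n G)
    nonempty    : 0 <ℕ ∣ core ∣
    min-degree  : ∀ v → core v ≡ true → c <ℕ deg edges core v
    homog-side  : Bool
    reference   : LinearOrder (Fin (n G))
    signs       : Fin d → Sign
    homogeneous : ∀ v → side v ≡ homog-side → ∀ w w′ → edges v w ≡ true → edges v w′ ≡ true →
                  w <[ reference ] w′ → ∀ i → Ordered (orders i) (signs i) w w′

induced : (E : EdgeSet N) → (∀ u w → E u w ≡ E w u) → (∀ v → E v v ≡ false) → Subset N → Graph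
induced E E-sym E-loopless S = record
  { n = ∣ S ∣ ; adj = λ x y → E (enum S x) (enum S y)
  ; symm = λ x y → E-sym (enum S x) (enum S y) ; irrefl = λ x → E-loopless (enum S x) }

degree-induced : (E : EdgeSet N) (E-sym : ∀ u w → E u w ≡ E w u) (E-loopless : ∀ v → E v v ≡ false)
  (S : Subset N) (x : Fin ∣ S ∣) → degree (induced E E-sym E-loopless S) x ≡ deg E S (enum S x)
degree-induced E E-sym E-loopless S x = begin
  degree (induced E E-sym E-loopless S) x          ≡⟨ degree≡ (induced E E-sym E-loopless S) x ⟩
  sum (𝟙 ∘ E (enum S x) ∘ enum S)                  ≡⟨ sum-enum S (𝟙 ∘ E (enum S x)) ⟩
  sum (λ w → if S w then 𝟙 (E (enum S x) w) else 0) ≡⟨ sum-cong-≗ (λ w → if-indicator (S w) _) ⟩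
  deg E S (enum S x)                               ∎
  where
  open ≡-Reasoning
  if-indicator : ∀ a b → (if a then 𝟙 b else 0) ≡ 𝟙 (a ∧ b)
  if-indicator true  b = refl
  if-indicator false b = refl

module _ (H G : Graph) (f : Fin (n H) → Fin (n G)) (embedding : SubgraphVia H G f) {d : ℕ}
         (R : Representation G d) where
  private
    f-injective : Injective _≡_ _≡_ f
    f-injective = proj₁ embedding

  restrict : Representation H d
  restrict i = pullback f f-injective (R i)

  -- disjoint edges of H are mapped to disjoint edges of G
  restrict-separating : Separating G R → Separating H restrict
  restrict-separating sep u v x y uv xy u≢x u≢y v≢x v≢y =
    sep (f u) (f v) (f x) (f y) (proj₂ embedding u v uv) (proj₂ embedding x y xy)
      (u≢x ∘ f-injective) (u≢y ∘ f-injective) (v≢x ∘ f-injective) (v≢y ∘ f-injective)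

  restrict-homogeneous : (side : Fin (n H) → Bool) (b : Bool) (L₀ : LinearOrder (Fin (n G))) (a : Fin d → Sign) →
    (∀ v → side v ≡ b → ∀ (w w′ : Nbhd H v) → f (proj₁ w) <[ L₀ ] f (proj₁ w′) →
       ∀ i → Ordered (R i) (a i) (f (proj₁ w)) (f (proj₁ w′))) →
    Homogeneous H side b restrict
  restrict-homogeneous side b L₀ a ordered =
    a , λ v v-side → nbhd-order v , λ i → ordered-as v i (a i) (λ w w′ w<w′ → ordered v v-side w w′ w<w′ i)
    where
    nbhd-injective : ∀ v → Injective _≡_ _≡_ (λ (w : Nbhd H v) → f (proj₁ w))
    nbhd-injective v {w , p} {w′ , p′} eq with f-injective eq
    ... | refl = cong (w ,_) (Decidable⇒UIP.≡-irrelevant Bool._≟_ p p′)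
    nbhd-order : ∀ v → LinearOrder (Nbhd H v)
    nbhd-order v = pullback (λ w → f (proj₁ w)) (nbhd-injective v) L₀
    ordered-as : ∀ v i s → (∀ (w w′ : Nbhd H v) → f (proj₁ w) <[ L₀ ] f (proj₁ w′) →
                   Ordered (R i) s (f (proj₁ w)) (f (proj₁ w′))) →
                 OrderedAs H v (restrict i) s (nbhd-order v)
    ordered-as v i Sign.+ h = h
    ordered-as v i Sign.- h = h

skeleton-subgraph : {G : Graph} {d c : ℕ} → Skeleton G d c → HomogeneousSubgraph d (suc c) G
skeleton-subgraph {G} {d} {c} K =
  G′ , nonempty , f , embedding , side ∘ f , (λ u w e → bipartite (f u) (f w) e) ,
  (λ x → subst (suc c ≤_) (sym (degree-induced edges symmetric loopless core x))
                (min-degree (f x) (enum-member core x))) ,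
  restrict G′ G f embedding orders , restrict-separating G′ G f embedding orders separating ,
  (λ v w e v-false w-true i → increasing i (f v) (f w) e v-false w-true) ,
  homogeneous′
  where
  open Skeleton K
  loopless : ∀ v → edges v v ≡ false
  loopless = bipartite-loopless bipartite
  G′ : Graph
  G′ = induced edges symmetric loopless core
  f : Fin ∣ core ∣ → Fin (n G)
  f = enum core
  embedding : SubgraphVia G′ G f
  embedding = enum-injective core , λ u w e → edges⊆ (f u) (f w) e
  homogeneous′ : Homogeneous G′ (side ∘ f) false (restrict G′ G f embedding orders) ⊎
                 Homogeneous G′ (side ∘ f) true  (restrict G′ G f embedding orders)
  homogeneous′ with homog-side
                   | restrict-homogeneous G′ G f embedding orders (side ∘ f) homog-side reference signs
                       (λ v v-side w w′ → homogeneous (f v) v-side (f (proj₁ w)) (f (proj₁ w′))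
                                                      (proj₂ w) (proj₂ w′))
  ... | false | h = inj₁ h
  ... | true  | h = inj₂ h

-- A separating representation of size k ≤ d is padded to size d by repeating an order.
pad : {G : Graph} {k d : ℕ} → 1 ≤ k → k ≤ d → (R : Representation G k) → Separating G R →
      Σ (Representation G d) (Separating G)
pad {G} {suc k} _ k≤d R sep with m≤n⇒∃[o]m+o≡n k≤d
... | m , refl = padded , separating
  where
  padded : Representation G (suc k + m)
  padded i = [ R , (λ _ → R zero) ]′ (splitAt (suc k) i)
  separating : Separating G padded
  separating u v x y uv xy u≢x u≢y v≢x v≢y =
    let j , before = sep u v x y uv xy u≢x u≢y v≢x v≢y
    in j ↑ˡ m , subst (λ o → Before o u v x y ⊎ Before o x y u v)
                      (sym (cong [ R , (λ _ → R zero) ]′ (splitAt-↑ˡ (suc k) j m))) before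

orient-separating : {G : Graph} {k : ℕ} (R : Representation G k) (σ : Fin k → Bool) →
  Separating G R → Separating G (λ i → orient (σ i) (R i))
orient-separating R σ sep u v x y uv xy u≢x u≢y v≢x v≢y =
  let i , before = sep u v x y uv xy u≢x u≢y v≢x v≢y in i , flip-before (σ i) before
  where
  flip-before : ∀ {L} b → Before L u v x y ⊎ Before L x y u v →
                Before (orient b L) u v x y ⊎ Before (orient b L) x y u v
  flip-before true  before = before
  flip-before false (inj₁ ((u<x , u<y) , (v<x , v<y))) = inj₂ ((u<x , v<x) , (u<y , v<y))
  flip-before false (inj₂ ((x<u , x<v) , (y<u , y<v))) = inj₁ ((x<u , y<u) , (x<v , y<v))

record ConsistentPart (G : Graph) (d : ℕ) : Set₁ where
  field
    side       : Fin (n G) → Bool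
    edges      : EdgeSet (n G)
    edges⊆     : ∀ u w → edges u w ≡ true → Edge G u w
    symmetric  : ∀ u w → edges u w ≡ edges w u
    bipartite  : Bipartite side edges
    heavy      : degreeSum G ≤ 2 ^ suc d * W edges
    orders     : Representation G d
    separating : Separating G orders
    increasing : ∀ i → Increasing side edges (orders i)

-- Stage 1: take a large cut of G and orient it consistently with every order.
consistent-part : {G : Graph} {d : ℕ} (R : Representation G d) → Separating G R → ConsistentPart G d
consistent-part {G} {d} R sep = record
  { side = s ; edges = edges ; edges⊆ = λ u w e → proj₁ (∧-true (sub u w e))
  ; symmetric = symmetric ; bipartite = λ u w e → cut-sides (adj G) s u w (sub u w e)
  ; heavy = begin
      degreeSum G           ≡⟨ degreeSum≡ G ⟩
      W (adj G)             ≤⟨ half ⟩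
      2 * W (cut (adj G) s) ≤⟨ *-monoʳ-≤ 2 heavy ⟩
      2 * (2 ^ d * W edges) ≡⟨ *-assoc 2 (2 ^ d) (W edges) ⟨
      2 ^ suc d * W edges   ∎
  ; orders = λ i → orient (signs i) (R i) ; separating = orient-separating {G} R signs sep
  ; increasing = increasing }
  where
  open ≤-Reasoning
  s : Fin (n G) → Bool
  s = proj₁ (large-cut (adj G) (symm G) (irrefl G))
  half : W (adj G) ≤ 2 * W (cut (adj G) s)
  half = proj₂ (large-cut (adj G) (symm G) (irrefl G))
  cut-sym : ∀ u w → cut (adj G) s u w ≡ cut (adj G) s w u
  cut-sym u w = cong₂ (λ e k → e ∧ not k) (symm G u w) (keep-sym (s u) (s w))
  open Orientation (orient-all s R cut-sym (cut-sides (adj G) s))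

module _ (centres : Subset N) (nbhd : Fin N → Subset N) where

  star : EdgeSet N
  star u w = centres u ∧ nbhd u w

  stars : EdgeSet N
  stars u w = star u w ∨ star w u

  stars-sym : ∀ u w → stars u w ≡ stars w u
  stars-sym u w = Bool.∨-comm (star u w) (star w u)

  stars-mass : (S : Subset N) → centres ⊆ S → (∀ v → centres v ≡ true → nbhd v ⊆ S) →
    (x : ℕ) → (∀ v → centres v ≡ true → x ≤ ∣ nbhd v ∣) → x * ∣ centres ∣ ≤ mass stars S
  stars-mass S centres⊆S nbhd⊆S x large = begin
    x * ∣ centres ∣                  ≡⟨ *-distribˡ-sum x (𝟙 ∘ centres) ⟩
    sum (λ u → x * 𝟙 (centres u))    ≤⟨ sum-mono (λ u → centre-row u (centres u) refl) ⟩
    mass stars S                     ∎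
    where
    open ≤-Reasoning
    counted : ∀ u w → centres u ≡ true → nbhd u w ≡ true → (S u ∧ (S w ∧ stars u w)) ≡ true
    counted u w u∈ w∈ rewrite centres⊆S u u∈ | nbhd⊆S u u∈ w w∈ | u∈ | w∈ = refl
    centre-row : ∀ u b → centres u ≡ b → x * 𝟙 b ≤ sum (inside stars S u)
    centre-row u false _  = ≤-trans (≤-reflexive (*-zeroʳ x)) z≤n
    centre-row u true  u∈ = begin
      x * 1                     ≡⟨ *-identityʳ x ⟩
      x                         ≤⟨ large u u∈ ⟩
      ∣ nbhd u ∣                ≤⟨ sum-mono (λ w → indicator-mono (counted u w u∈)) ⟩
      sum (inside stars S u)    ∎

  stars⊆ : (E : EdgeSet N) → (∀ u w → E u w ≡ E w u) →
    (∀ v → centres v ≡ true → ∀ w → nbhd v w ≡ true → E v w ≡ true) →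
    ∀ u w → stars u w ≡ true → E u w ≡ true
  stars⊆ E E-sym nbhd⊆E u w uw∈ with ∨-true {star u w} uw∈
  ... | inj₁ uw = nbhd⊆E u (proj₁ (∧-true uw)) w (proj₂ (∧-true uw))
  ... | inj₂ wu = trans (E-sym u w) (nbhd⊆E w (proj₁ (∧-true wu)) u (proj₂ (∧-true wu)))

module _ (side : Fin N → Bool) (E : EdgeSet N) (L₀ : LinearOrder (Fin N)) {D : ℕ}
         (R : Fin D → LinearOrder (Fin N)) where

  record StarSystem (S : Subset N) (x : ℕ) : Set where
    field
      centres     : Subset N
      nbhd        : Fin N → Subset N
      centre-side : Bool
      on-side     : ∀ v → centres v ≡ true → side v ≡ centre-side
      centres⊆    : centres ⊆ S
      nbhd⊆       : ∀ v → centres v ≡ true → nbhd v ⊆ (λ w → S w ∧ E v w)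
      many        : ∣ S ∣ ≤ 2 * 2 ^ D * ∣ centres ∣
      large       : ∀ v → centres v ≡ true → x ≤ ∣ nbhd v ∣
      signs       : Fin D → Sign
      homogeneous : ∀ v → centres v ≡ true → ∀ i → Monotone L₀ (R i) (signs i) (nbhd v)

  -- Take the larger side of S and homogenise the neighbourhoods of its vertices.
  star-system : (S : Subset N) (x : ℕ) → (∀ v → S v ≡ true → x ^ (2 ^ D) ≤ deg E S v) → StarSystem S x
  star-system S x big = record
    { centres = centres ; nbhd = nbhd ; centre-side = b
    ; on-side = λ v v∈ → keep-sound b (side v) (proj₂ (∧-true (centres⊆ v v∈)))
    ; centres⊆ = λ v v∈ → proj₁ (∧-true (centres⊆ v v∈))
    ; nbhd⊆ = nbhd⊆
    ; many = ≤-trans half (≤-trans (*-monoʳ-≤ 2 many) (≤-reflexive (sym (*-assoc 2 (2 ^ D) ∣ centres ∣))))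
    ; large = large ; signs = signs ; homogeneous = homogeneous }
    where
    b : Bool
    b = proj₁ (count-majority S side)
    half : ∣ S ∣ ≤ 2 * ∣ (λ v → S v ∧ keep b (side v)) ∣
    half = proj₂ (count-majority S side)
    open Homogenised (homogenise L₀ x R (λ v → S v ∧ keep b (side v)) (λ v w → S w ∧ E v w)
                                     (λ v v∈ → big v (proj₁ (∧-true v∈))))

-- The stars of a star system keep enough mass for a core of minimum degree
-- t′ + 1, and around that core they form a skeleton.
star-skeleton : {G : Graph} {D : ℕ} (P : ConsistentPart G (suc D)) {S : Subset (n G)} {x : ℕ} (t′ : ℕ) →
  StarSystem (ConsistentPart.side P) (ConsistentPart.edges P)
             (ConsistentPart.orders P zero) (ConsistentPart.orders P ∘ suc) S x →
  0 <ℕ ∣ S ∣ → 2 * 2 ^ D * (2 * suc t′) ≤ x → Skeleton G (suc D) t′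
star-skeleton {G} {D} P {S} {x} t′ system S-nonempty threshold = record
  { edges = E₂ ; edges⊆ = λ u w e → edges⊆ u w (E₂⊆E u w e) ; symmetric = stars-sym centres nbhd
  ; side = side ; bipartite = E₂-bipartite
  ; orders = orders ; separating = separating
  ; increasing = λ i v w e → increasing i v w (E₂⊆E v w e)
  ; core = DenseCore.vertices C₂ ; nonempty = DenseCore.nonempty C₂ ; min-degree = DenseCore.min-degree C₂
  ; homog-side = centre-side ; reference = orders zero
  ; signs = signs′
  ; homogeneous = homogeneous′ }
  where
  open ConsistentPart P
  open StarSystem system
  -- the reference order is orders zero itself
  signs′ : Fin (suc D) → Sign
  signs′ zero    = Sign.+
  signs′ (suc i) = signs i
  E₂ : EdgeSet (n G)
  E₂ = stars centres nbhd
  E₂⊆E : ∀ u w → E₂ u w ≡ true → edges u w ≡ true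
  E₂⊆E = stars⊆ centres nbhd edges symmetric (λ v v∈ w w∈ → proj₂ (∧-true (nbhd⊆ v v∈ w w∈)))
  nbhd⊆S : ∀ v → centres v ≡ true → nbhd v ⊆ S
  nbhd⊆S v v∈ w w∈ = proj₁ (∧-true (nbhd⊆ v v∈ w w∈))
  E₂-bipartite : Bipartite side E₂
  E₂-bipartite u w e = bipartite u w (E₂⊆E u w e)
  dense : 2 * suc t′ * ∣ S ∣ ≤ mass E₂ S
  dense = begin
    2 * suc t′ * ∣ S ∣                         ≤⟨ *-monoʳ-≤ (2 * suc t′) many ⟩
    2 * suc t′ * (2 * 2 ^ D * ∣ centres ∣)     ≡⟨ *-assoc (2 * suc t′) (2 * 2 ^ D) _ ⟨
    2 * suc t′ * (2 * 2 ^ D) * ∣ centres ∣     ≡⟨ cong (_* ∣ centres ∣) (*-comm (2 * suc t′) (2 * 2 ^ D)) ⟩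
    2 * 2 ^ D * (2 * suc t′) * ∣ centres ∣     ≤⟨ *-monoˡ-≤ ∣ centres ∣ threshold ⟩
    x * ∣ centres ∣                            ≤⟨ stars-mass centres nbhd S centres⊆ nbhd⊆S x large ⟩
    mass E₂ S                                  ∎
    where open ≤-Reasoning
  C₂ : DenseCore E₂ t′ S
  C₂ = core-of-average E₂ (stars-sym centres nbhd) (bipartite-loopless E₂-bipartite) t′ S S-nonempty dense
  outward : ∀ v w → side v ≡ centre-side → E₂ v w ≡ true → centres v ≡ true × nbhd v w ≡ true
  outward v w v-side vw∈ with ∨-true {star centres nbhd v w} vw∈
  ... | inj₁ vw = ∧-true vw
  ... | inj₂ wv = contradiction (trans (on-side w (proj₁ (∧-true wv))) (sym v-side))
                                (E₂-bipartite w v (trans (stars-sym centres nbhd w v) vw∈))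
  homogeneous′ : ∀ v → side v ≡ centre-side → ∀ w w′ → E₂ v w ≡ true → E₂ v w′ ≡ true →
    w <[ orders zero ] w′ → ∀ i → Ordered (orders i) (signs′ i) w w′
  homogeneous′ v v-side w w′ vw∈ vw′∈ w<w′ zero    = w<w′
  homogeneous′ v v-side w w′ vw∈ vw′∈ w<w′ (suc i) =
    homogeneous v (proj₁ (outward v w v-side vw∈)) i w w′
      (proj₂ (outward v w v-side vw∈)) (proj₂ (outward v w′ v-side vw′∈)) w<w′

consistent-density : {G : Graph} {d : ℕ} (P : ConsistentPart G d) (K : ℕ) →
  AvgDegreeAtLeast G (2 ^ suc d * (2 * K)) → 2 * K * n G ≤ W (ConsistentPart.edges P)
consistent-density {G} {d} P K avg = *-cancelˡ-≤ (2 ^ suc d) {{m^n≢0 2 (suc d)}} (begin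
  2 ^ suc d * (2 * K * n G) ≡⟨ *-assoc (2 ^ suc d) (2 * K) (n G) ⟨
  2 ^ suc d * (2 * K) * n G ≤⟨ avg ⟩
  degreeSum G               ≤⟨ heavy ⟩
  2 ^ suc d * W edges       ∎)
  where
  open ≤-Reasoning
  open ConsistentPart P

first-core : {G : Graph} {d : ℕ} (P : ConsistentPart G d) (K : ℕ) .{{_ : NonZero K}} → 1 ≤ n G →
  2 * K * n G ≤ W (ConsistentPart.edges P) →
  Σ (Subset (n G)) λ S → 0 <ℕ ∣ S ∣ × (∀ v → S v ≡ true → K ≤ deg (ConsistentPart.edges P) S v)
first-core {G} P K n≥1 dense =
  vertices , nonempty , λ v v∈ → subst (_≤ deg edges vertices v) (suc-pred K) (min-degree v v∈)
  where
  open ConsistentPart P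
  everything : Subset (n G)
  everything _ = true
  open DenseCore (core-of-average edges symmetric (bipartite-loopless bipartite) (pred K) everything
    (subst (0 <ℕ_) (sym (count-all {n G})) n≥1)
    (subst (λ m → 2 * suc (pred K) * m ≤ W edges) (sym (count-all {n G}))
           (subst (λ k → 2 * k * n G ≤ W edges) (sym (suc-pred K)) dense)))

-- the constants of the theorem: bound d t = 2^(d+1) · 2K with K = x^(2^(d-1))
-- for x = 2^(d+1) t
bound-split : (D t : ℕ) → bound (suc D) t ≡ 2 ^ suc (suc D) * (2 * (2 ^ (suc D + 1) * t) ^ (2 ^ D))
bound-split D t = begin
  2 ^ (suc D + 2) * K         ≡⟨ cong (_* K) (^-distribˡ-+-* 2 (suc D) 2) ⟩
  2 * 2 ^ D * 4 * K           ≡⟨ regroup (2 ^ D) K ⟩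
  2 * (2 * 2 ^ D) * (2 * K)   ∎
  where
  open ≡-Reasoning
  regroup : ∀ p k → 2 * p * 4 * k ≡ 2 * (2 * p) * (2 * k)
  regroup = solve-∀
  K : ℕ
  K = (2 ^ (suc D + 1) * t) ^ (2 ^ D)

-- x = 2^(d+1) t is exactly the threshold star-skeleton needs for t
threshold : (D t : ℕ) → 2 * 2 ^ D * (2 * t) ≡ 2 ^ (suc D + 1) * t
threshold D t = begin
  2 * 2 ^ D * (2 * t)     ≡⟨ regroup (2 ^ D) t ⟩
  2 * 2 ^ D * 2 * t       ≡⟨ cong (_* t) (^-distribˡ-+-* 2 (suc D) 1) ⟨
  2 ^ (suc D + 1) * t     ∎
  where
  open ≡-Reasoning
  regroup : ∀ p t → 2 * p * (2 * t) ≡ 2 * p * 2 * t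
  regroup = solve-∀

lemma13 : (d t : ℕ) → 1 ≤ d → 1 ≤ t →
  (G : Graph) → 1 ≤ n G →
  AvgDegreeAtLeast G (bound d t) → SepDimAtMost G d →
  Σ Graph λ G' → 1 ≤ n G' ×
    Σ (Fin (n G') → Fin (n G)) λ f → SubgraphVia G' G f ×
    Σ (Fin (n G') → Bool) λ side → IsBipartition G' side ×
    MinDegreeAtLeast G' t ×
    Σ (Representation G' d) λ R →
      Separating G' R × Consistent G' side R ×
      (Homogeneous G' side false R ⊎ Homogeneous G' side true R)
lemma13 (suc D) (suc t′) _ _ G n≥1 avg (k , k≥1 , k≤d , R , sep) =
  skeleton-subgraph (star-skeleton P t′ system (proj₁ (proj₂ S₁)) (≤-reflexive (threshold D (suc t′))))
  where
  x K : ℕ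
  x = 2 ^ (suc D + 1) * suc t′
  K = x ^ (2 ^ D)
  instance
    K-nonzero : NonZero K
    K-nonzero = m^n≢0 x (2 ^ D) {{m*n≢0 (2 ^ (suc D + 1)) (suc t′) {{m^n≢0 2 (suc D + 1)}}}}
  padded : Σ (Representation G (suc D)) (Separating G)
  padded = pad {G} k≥1 k≤d R sep
  P : ConsistentPart G (suc D)
  P = consistent-part {G} (proj₁ padded) (proj₂ padded)
  open ConsistentPart P
  S₁ : Σ (Subset (n G)) λ S → 0 <ℕ ∣ S ∣ × (∀ v → S v ≡ true → K ≤ deg edges S v)
  S₁ = first-core P K n≥1 (consistent-density P K
         (subst (λ b → b * n G ≤ degreeSum G) (bound-split D (suc t′)) avg))
  system : StarSystem side edges (orders zero) (orders ∘ suc) (proj₁ S₁) x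
  system = star-system side edges (orders zero) (orders ∘ suc) (proj₁ S₁) x (proj₂ (proj₂ S₁))
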